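{- Let $(b_n)_{n\in\mathbb Z}$ be a lens sequence with constant $\beta$. Then for every $n$ $$\det\begin{bmatrix} b_{n+1}-\beta & b_{n+2}\\ b_{n-1} & b_n-\beta\end{bmatrix}=0.$$
   Context: A lens sequence is a bilateral real sequence $(b_n)_{n\in\mathbb Z}$ obtained from a seed $(a,b,c)$ with $b\neq0$ placed at three consecutive positions, extended in both directions by $b_n=\alpha b_{n-1}-b_{n-2}+\beta$, where $\alpha=\frac{ab+bc+ca}{b^2}-1$ and $\beta=\frac{b^2-ac}{b}$; these constants do not depend on the choice of the three consecutive terms. -}

module Defs where

open import Level using (Level; _⊔_)
open import Algebra.Bundles using (CommutativeRing)
open import Data.Integer using (ℤ; +_) renaming (_+_ to _+ℤ_; _-_ to _-ℤ_)

-- The paper works over ℝ. The standard library has no reals, so we work over an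
-- arbitrary commutative ring R (ℝ being one instance); the condition "b ≠ 0"
-- is rendered as "b is invertible", with an explicit inverse (equivalent to
-- b ≠ 0 in a field such as ℝ).

module _ {c ℓ : Level} (R : CommutativeRing c ℓ) where
  open CommutativeRing R

  det₂ : Carrier → Carrier → Carrier → Carrier → Carrier
  det₂ p q r t = p * t - q * r

  lensα : Carrier → Carrier → Carrier → Carrier → Carrier
  lensα a b c' binv = (a * b + b * c' + c' * a) * (binv * binv) - 1#

  lensβ : Carrier → Carrier → Carrier → Carrier → Carrier
  lensβ a b c' binv = (b * b - a * c') * binv

  record IsLensSequence (s : ℤ → Carrier) : Set (c ⊔ ℓ) where
    field
      k       : ℤ
      bInv    : Carrier
      bInv-*  : s k * bInv ≈ 1#
    field
      recurrence : ∀ (n : ℤ) →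
        s n ≈ lensα (s (k -ℤ + 1)) (s k) (s (k +ℤ + 1)) bInv * s (n -ℤ + 1)
              - s (n -ℤ + 2)
              + lensβ (s (k -ℤ + 1)) (s k) (s (k +ℤ + 1)) bInv

    α β : Carrier
    α = lensα (s (k -ℤ + 1)) (s k) (s (k +ℤ + 1)) bInv
    β = lensβ (s (k -ℤ + 1)) (s k) (s (k +ℤ + 1)) bInv

{-# OPTIONS --safe #-}
module Submission where

-- Put Φ(x, y) = x² + y² − αxy − β(x + y). Since Φ(x, b_n) is a monic quadratic in x
-- with roots summing to αb_n + β = b_{n+1} + b_{n−1}, it takes equal values at
-- b_{n+1} and b_{n−1}; as Φ is symmetric, Φ(b_{n+1}, b_n) = Φ(b_n, b_{n−1}), so this
-- value does not depend on n. At the seed, clearing the denominator b in α and β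
-- shows it is 0. Eliminating b_{n+1} and b_{n+2} by the recurrence turns the
-- determinant into α Φ(b_n, b_{n−1}) = 0.

open import Defs
open import Level using (Level)
open import Algebra.Bundles using (CommutativeRing)
open import Algebra.Solver.Ring.AlmostCommutativeRing
  using (fromCommutativeRing; _-Raw-AlmostCommutative⟶_)
import Data.Integer as ℤ
open import Data.Integer.Base using (ℤ; +_; -[1+_]; _⊖_; 0ℤ)
import Data.Integer.Properties as ℤ
open import Data.Integer.Tactic.RingSolver using (solve-∀)
open import Data.Maybe.Base using (Maybe; just; nothing)
open import Data.Nat.Base as ℕ using (zero; suc)
import Data.Nat.Properties as ℕ
open import Relation.Binary.Bundles using (Setoid)
open import Relation.Binary.PropositionalEquality as ≡ using (_≡_)
open import Relation.Nullary.Decidable using (yes; no)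

module _ {a ℓ : Level} (S : Setoid a ℓ) where
  open Setoid S

  shift-invariant⇒constant : (f : ℤ → Carrier) → (∀ i → f (i ℤ.+ + 1) ≈ f i) → ∀ i j → f i ≈ f j
  shift-invariant⇒constant f f-shift i j = trans (f≈f0 i) (sym (f≈f0 j))
    where
    f≈f0 : ∀ i → f i ≈ f 0ℤ
    f≈f0 (+ zero)     = refl
    f≈f0 (+ suc m)    = trans (reflexive (≡.cong (λ n → f (+ n)) (ℕ.+-comm 1 m)))
                             (trans (f-shift (+ m)) (f≈f0 (+ m)))
    f≈f0 -[1+ zero ]  = sym (f-shift -[1+ zero ])
    f≈f0 -[1+ suc m ] = trans (sym (f-shift -[1+ suc m ])) (f≈f0 -[1+ m ])

i+1-1≡i : ∀ i → i ℤ.+ + 1 ℤ.- + 1 ≡ i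
i+1-1≡i = solve-∀

i+1-2≡i-1 : ∀ i → i ℤ.+ + 1 ℤ.- + 2 ≡ i ℤ.- + 1
i+1-2≡i-1 = solve-∀

i+2-1≡i+1 : ∀ i → i ℤ.+ + 2 ℤ.- + 1 ≡ i ℤ.+ + 1
i+2-1≡i+1 = solve-∀

i+2-2≡i : ∀ i → i ℤ.+ + 2 ℤ.- + 2 ≡ i
i+2-2≡i = solve-∀

-- The ring solver needs coefficients with a (semi-)decidable equality, which
-- an arbitrary R lacks; ℤ serves, via the homomorphism n ↦ n · 1#.
module IntegerCoefficients {c ℓ : Level} (R : CommutativeRing c ℓ) where
  open CommutativeRing R
  open import Algebra.Properties.AbelianGroup +-abelianGroup using (⁻¹-∙-comm; xyx⁻¹≈y)
  open import Algebra.Properties.Group +-group using (ε⁻¹≈ε; ⁻¹-involutive)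
  open import Algebra.Properties.Ring ring using (-‿distribˡ-*; -‿distribʳ-*)
  open import Algebra.Properties.Semiring.Mult semiring using (_×_; ×-homo-+; ×1-homo-*)
  open import Relation.Binary.Reasoning.Setoid setoid

  ⟦_⟧ : ℤ → Carrier
  ⟦ + n ⟧      = n × 1#
  ⟦ -[1+ n ] ⟧ = - (suc n × 1#)

  ⊖-homo : ∀ m n → ⟦ m ⊖ n ⟧ ≈ m × 1# - n × 1#
  ⊖-homo m       zero    = sym (trans (+-congˡ ε⁻¹≈ε) (+-identityʳ _))
  ⊖-homo zero    (suc n) = sym (+-identityˡ _)
  ⊖-homo (suc m) (suc n) = begin
    ⟦ suc m ⊖ suc n ⟧                    ≡⟨ ≡.cong ⟦_⟧ (ℤ.[1+m]⊖[1+n]≡m⊖n m n) ⟩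
    ⟦ m ⊖ n ⟧                            ≈⟨ ⊖-homo m n ⟩
    m × 1# - n × 1#                      ≈⟨ +-congʳ (xyx⁻¹≈y 1# (m × 1#)) ⟨
    1# + m × 1# - 1# - n × 1#            ≈⟨ +-assoc _ (- 1#) _ ⟩
    1# + m × 1# + (- 1# - n × 1#)        ≈⟨ +-congˡ (⁻¹-∙-comm 1# (n × 1#)) ⟩
    1# + m × 1# - (1# + n × 1#)          ∎

  -‿homo : ∀ i → ⟦ ℤ.- i ⟧ ≈ - ⟦ i ⟧
  -‿homo (+ zero)  = sym ε⁻¹≈ε
  -‿homo (+ suc n) = refl
  -‿homo -[1+ n ]  = sym (⁻¹-involutive _)

  +-homo : ∀ i j → ⟦ i ℤ.+ j ⟧ ≈ ⟦ i ⟧ + ⟦ j ⟧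
  +-homo (+ m)    (+ n)    = ×-homo-+ 1# m n
  +-homo (+ m)    -[1+ n ] = ⊖-homo m (suc n)
  +-homo -[1+ m ] (+ n)    = trans (⊖-homo n (suc m)) (+-comm _ _)
  +-homo -[1+ m ] -[1+ n ] = begin
    - (suc (suc (m ℕ.+ n)) × 1#)         ≡⟨ ≡.cong (λ k → - (k × 1#)) (ℕ.+-suc (suc m) n) ⟨
    - ((suc m ℕ.+ suc n) × 1#)           ≈⟨ -‿cong (×-homo-+ 1# (suc m) (suc n)) ⟩
    - (suc m × 1# + suc n × 1#)          ≈⟨ ⁻¹-∙-comm _ _ ⟨
    - (suc m × 1#) - suc n × 1#          ∎

  *-homo-+ : ∀ m j → ⟦ + m ℤ.* j ⟧ ≈ ⟦ + m ⟧ * ⟦ j ⟧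
  *-homo-+ m (+ n) = begin
    ⟦ + m ℤ.* + n ⟧                      ≡⟨ ≡.cong ⟦_⟧ (ℤ.pos-* m n) ⟨
    (m ℕ.* n) × 1#                       ≈⟨ ×1-homo-* m n ⟩
    m × 1# * n × 1#                      ∎
  *-homo-+ m -[1+ n ] = begin
    ⟦ + m ℤ.* -[1+ n ] ⟧                 ≡⟨ ≡.cong ⟦_⟧ (ℤ.neg-distribʳ-* (+ m) (+ suc n)) ⟨
    ⟦ ℤ.- (+ m ℤ.* + suc n) ⟧            ≈⟨ -‿homo (+ m ℤ.* + suc n) ⟩
    - ⟦ + m ℤ.* + suc n ⟧                ≈⟨ -‿cong (*-homo-+ m (+ suc n)) ⟩
    - (m × 1# * suc n × 1#)              ≈⟨ -‿distribʳ-* _ _ ⟩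
    m × 1# * - (suc n × 1#)              ∎

  *-homo : ∀ i j → ⟦ i ℤ.* j ⟧ ≈ ⟦ i ⟧ * ⟦ j ⟧
  *-homo (+ m)    j = *-homo-+ m j
  *-homo -[1+ m ] j = begin
    ⟦ -[1+ m ] ℤ.* j ⟧                   ≡⟨ ≡.cong ⟦_⟧ (ℤ.neg-distribˡ-* (+ suc m) j) ⟨
    ⟦ ℤ.- (+ suc m ℤ.* j) ⟧              ≈⟨ -‿homo (+ suc m ℤ.* j) ⟩
    - ⟦ + suc m ℤ.* j ⟧                  ≈⟨ -‿cong (*-homo-+ (suc m) j) ⟩
    - (suc m × 1# * ⟦ j ⟧)               ≈⟨ -‿distribˡ-* _ _ ⟩
    - (suc m × 1#) * ⟦ j ⟧               ∎

  ℤ⟶R : ℤ.+-*-rawRing -Raw-AlmostCommutative⟶ fromCommutativeRing R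
  ℤ⟶R = record
    { ⟦_⟧ = ⟦_⟧ ; +-homo = +-homo ; *-homo = *-homo ; -‿homo = -‿homo
    ; 0-homo = refl ; 1-homo = +-identityʳ 1# }

  ⟦⟧-≟ : ∀ i j → Maybe (⟦ i ⟧ ≈ ⟦ j ⟧)
  ⟦⟧-≟ i j with i ℤ.≟ j
  ... | yes ≡.refl = just refl
  ... | no _       = nothing

  open import Algebra.Solver.Ring ℤ.+-*-rawRing (fromCommutativeRing R) ℤ⟶R ⟦⟧-≟ public
    using (solve; _:=_; _:+_; _:*_; _:-_)

module LensAlgebra {c ℓ : Level} (R : CommutativeRing c ℓ) where
  open CommutativeRing R
  open IntegerCoefficients R
  open import Algebra.Properties.Group +-group using (x≈y⇒x∙y⁻¹≈ε)
  open import Relation.Binary.Reasoning.Setoid setoid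

  lensForm : Carrier → Carrier → Carrier → Carrier → Carrier
  lensForm α β x y = x * x + y * y - α * x * y - β * (x + y)

  lensForm-cong : ∀ α β {x x′ y y′} → x ≈ x′ → y ≈ y′ → lensForm α β x y ≈ lensForm α β x′ y′
  lensForm-cong α β x≈ y≈ =
    +-cong (+-cong (+-cong (*-cong x≈ x≈) (*-cong y≈ y≈)) (-‿cong (*-cong (*-congˡ x≈) y≈)))
           (-‿cong (*-congˡ (+-cong x≈ y≈)))

  det₂-cong : ∀ {p p′ q q′ r r′ t t′} → p ≈ p′ → q ≈ q′ → r ≈ r′ → t ≈ t′ →
              det₂ R p q r t ≈ det₂ R p′ q′ r′ t′
  det₂-cong p≈ q≈ r≈ t≈ = +-cong (*-cong p≈ t≈) (-‿cong (*-cong q≈ r≈))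

  lensForm-step : ∀ α β y z → lensForm α β (α * y - z + β) y ≈ lensForm α β y z
  lensForm-step = solve 4 (λ α β y z →
      let x = α :* y :- z :+ β in
      x :* x :+ y :* y :- α :* x :* y :- β :* (x :+ y)
    := y :* y :+ z :* z :- α :* y :* z :- β :* (y :+ z)) refl

  det₂-step : ∀ α β y z → let x = α * y - z + β in
              det₂ R (x - β) (α * x - y + β) z (y - β) ≈ α * lensForm α β y z
  det₂-step = solve 4 (λ α β y z →
      let x = α :* y :- z :+ β in
      (x :- β) :* (y :- β) :- (α :* x :- y :+ β) :* z
    := α :* (y :* y :+ z :* z :- α :* y :* z :- β :* (y :+ z))) refl

  unit*unit*x≈0⇒x≈0 : ∀ {u v x} → u * v ≈ 1# → u * u * x ≈ 0# → x ≈ 0#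
  unit*unit*x≈0⇒x≈0 {u} {v} {x} uv≈1 uux≈0 = begin
    x                      ≈⟨ *-identityˡ x ⟨
    1# * x                 ≈⟨ *-congʳ (trans (*-cong uv≈1 uv≈1) (*-identityˡ 1#)) ⟨
    u * v * (u * v) * x    ≈⟨ solve 3 (λ u v x → u :* v :* (u :* v) :* x := v :* v :* (u :* u :* x)) refl u v x ⟩
    v * v * (u * u * x)    ≈⟨ *-congˡ uux≈0 ⟩
    v * v * 0#             ≈⟨ zeroʳ _ ⟩
    0#                     ∎

  module _ {a b c′ b⁻¹ : Carrier} (b*b⁻¹≈1 : b * b⁻¹ ≈ 1#) where
    private
      α = lensα R a b c′ b⁻¹
      β = lensβ R a b c′ b⁻¹

    x*[b*b⁻¹]≈x : ∀ x → x * (b * b⁻¹) ≈ x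
    x*[b*b⁻¹]≈x x = trans (*-congˡ b*b⁻¹≈1) (*-identityʳ x)

    -- 1# is a solver variable here: the constant 1 would evaluate to 1# + 0#.
    lensα*b² : α * (b * b) ≈ a * b + b * c′ + c′ * a - b * b
    lensα*b² = begin
      α * (b * b)
        ≈⟨ solve 4 (λ σ i b o → (σ :* (i :* i) :- o) :* (b :* b)
                              := σ :* (b :* i) :* (b :* i) :- o :* (b :* b)) refl σ b⁻¹ b 1# ⟩
      σ * (b * b⁻¹) * (b * b⁻¹) - 1# * (b * b)
        ≈⟨ +-cong (trans (x*[b*b⁻¹]≈x _) (x*[b*b⁻¹]≈x σ)) (-‿cong (*-identityˡ _)) ⟩
      σ - b * b ∎
      where σ = a * b + b * c′ + c′ * a

    lensβ*b : β * b ≈ b * b - a * c′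
    lensβ*b = trans (solve 3 (λ τ i b → τ :* i :* b := τ :* (b :* i)) refl τ b⁻¹ b) (x*[b*b⁻¹]≈x τ)
      where τ = b * b - a * c′

    lensForm-seed : lensForm α β b a ≈ 0#
    lensForm-seed = unit*unit*x≈0⇒x≈0 b*b⁻¹≈1 (begin
      b * b * lensForm α β b a
        ≈⟨ solve 4 (λ α β a b → b :* b :* (b :* b :+ a :* a :- α :* b :* a :- β :* (b :+ a))
                              := b :* b :* (b :* b :+ a :* a) :- (a :* b :* (α :* (b :* b)) :+ b :* (β :* b) :* (b :+ a)))
                 refl α β a b ⟩
      b * b * (b * b + a * a) - (a * b * (α * (b * b)) + b * (β * b) * (b + a))
        ≈⟨ +-congˡ (-‿cong (+-cong (*-congˡ lensα*b²) (*-congʳ (*-congˡ lensβ*b)))) ⟩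
      b * b * (b * b + a * a) - (a * b * (a * b + b * c′ + c′ * a - b * b) + b * (b * b - a * c′) * (b + a))
        ≈⟨ x≈y⇒x∙y⁻¹≈ε (solve 3 (λ a b c → b :* b :* (b :* b :+ a :* a)
                                          := a :* b :* (a :* b :+ b :* c :+ c :* a :- b :* b) :+ b :* (b :* b :- a :* c) :* (b :+ a))
                                 refl a b c′) ⟩
      0# ∎)

module LensSequence {c ℓ : Level} (R : CommutativeRing c ℓ) {s : ℤ → CommutativeRing.Carrier R}
                    (L : IsLensSequence R s) where
  open CommutativeRing R
  open IsLensSequence L
  open LensAlgebra R

  recurrence-at : ∀ {m p q} → m ℤ.- + 1 ≡ p → m ℤ.- + 2 ≡ q → s m ≈ α * s p - s q + β
  recurrence-at {m} ≡.refl ≡.refl = recurrence m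

  invariant : ℤ → Carrier
  invariant n = lensForm α β (s n) (s (n ℤ.- + 1))

  invariant-shift : ∀ n → invariant (n ℤ.+ + 1) ≈ invariant n
  invariant-shift n = trans
    (lensForm-cong α β (recurrence-at (i+1-1≡i n) (i+1-2≡i-1 n)) (reflexive (≡.cong s (i+1-1≡i n))))
    (lensForm-step α β (s n) (s (n ℤ.- + 1)))

  invariant≈0 : ∀ n → invariant n ≈ 0#
  invariant≈0 n = trans (shift-invariant⇒constant setoid invariant invariant-shift n k) (lensForm-seed bInv-*)

  det₂≈α*invariant : ∀ n → det₂ R (s (n ℤ.+ + 1) - β) (s (n ℤ.+ + 2)) (s (n ℤ.- + 1)) (s n - β) ≈ α * invariant n
  det₂≈α*invariant n = trans (det₂-cong (+-congʳ s[n+1]≈) s[n+2]≈ refl refl) (det₂-step α β (s n) (s (n ℤ.- + 1)))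
    where
    s[n+1]≈ : s (n ℤ.+ + 1) ≈ α * s n - s (n ℤ.- + 1) + β
    s[n+1]≈ = recurrence-at (i+1-1≡i n) (i+1-2≡i-1 n)
    s[n+2]≈ : s (n ℤ.+ + 2) ≈ α * (α * s n - s (n ℤ.- + 1) + β) - s n + β
    s[n+2]≈ = trans (recurrence-at (i+2-1≡i+1 n) (i+2-2≡i n)) (+-congʳ (+-congʳ (*-congˡ s[n+1]≈)))

open import Data.Integer using (_+_; _-_)

corollary5p13 : {c ℓ : Level} (R : CommutativeRing c ℓ) (s : ℤ → CommutativeRing.Carrier R)
    (L : IsLensSequence R s) (n : ℤ) →
    CommutativeRing._≈_ R
      (det₂ R (CommutativeRing._-_ R (s (n + + 1)) (IsLensSequence.β L)) (s (n + + 2))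
              (s (n - + 1)) (CommutativeRing._-_ R (s n) (IsLensSequence.β L)))
      (CommutativeRing.0# R)
corollary5p13 R s L n = trans (det₂≈α*invariant n) (trans (*-congˡ (invariant≈0 n)) (zeroʳ α))
  where
  open CommutativeRing R using (trans; *-congˡ; zeroʳ)
  open IsLensSequence L using (α)
  open LensSequence R L using (det₂≈α*invariant; invariant≈0)
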